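{- Let $k\in\mathbb{R}$, $k>0$, let $M=\begin{pmatrix} k-1 & k-1 & k\\ 1&0&0\\ 0&1&0\end{pmatrix}$ and $N_0=\begin{pmatrix} k-1 & 2k & 2k\\ 2 & 1-k & 2\\ \frac{2}{k} & \frac{2}{k} & -\frac{1}{k}(k^2+k-2)\end{pmatrix}$. For integers $n\geq0$ put $\mathbf{J}_n=M^n$ and $\mathbf{j}_n=N_0M^n$. Then for all integers $m,n\geq 1$: $$\mathbf{j}_{m+n}=\mathbf{j}_m\mathbf{J}_n=\mathbf{J}_m\mathbf{j}_n.$$ -}

module Defs where

open import Level using (_⊔_)
open import Algebra.Bundles using (CommutativeRing)
open import Data.Nat using (ℕ; zero; suc)
open import Data.Fin using (Fin; zero; suc)

-- 3×3 matrices over a commutative ring R, with the entries of M and N₀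
-- from the paper.  k⁻¹ denotes a (two-sided, since R is commutative)
-- inverse of k; the paper's entries 2/k and -(1/k)(k²+k-2) are written
-- as 2·k⁻¹ and -(k⁻¹·(k²+k-2)).
module Matrices {c ℓ} (R : CommutativeRing c ℓ) where
  open CommutativeRing R hiding (zero)

  Mat3 : Set c
  Mat3 = Fin 3 → Fin 3 → Carrier

  _≈ₘ_ : Mat3 → Mat3 → Set ℓ
  A ≈ₘ B = ∀ i j → A i j ≈ B i j

  infixl 7 _⊗_
  _⊗_ : Mat3 → Mat3 → Mat3
  (A ⊗ B) i j = A i zero * B zero j + A i (suc zero) * B (suc zero) j
                  + A i (suc (suc zero)) * B (suc (suc zero)) j

  I₃ : Mat3
  I₃ zero zero = 1#
  I₃ (suc zero) (suc zero) = 1#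
  I₃ (suc (suc zero)) (suc (suc zero)) = 1#
  I₃ _ _ = 0#

  _^ₘ_ : Mat3 → ℕ → Mat3
  A ^ₘ zero = I₃
  A ^ₘ suc n = A ⊗ (A ^ₘ n)

  two : Carrier
  two = 1# + 1#

  Mₖ : Carrier → Mat3
  Mₖ k zero zero = k - 1#
  Mₖ k zero (suc zero) = k - 1#
  Mₖ k zero (suc (suc zero)) = k
  Mₖ k (suc zero) zero = 1#
  Mₖ k (suc zero) (suc zero) = 0#
  Mₖ k (suc zero) (suc (suc zero)) = 0#
  Mₖ k (suc (suc zero)) zero = 0#
  Mₖ k (suc (suc zero)) (suc zero) = 1#
  Mₖ k (suc (suc zero)) (suc (suc zero)) = 0#

  N₀ : Carrier → Carrier → Mat3
  N₀ k k⁻¹ zero zero = k - 1#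
  N₀ k k⁻¹ zero (suc zero) = two * k
  N₀ k k⁻¹ zero (suc (suc zero)) = two * k
  N₀ k k⁻¹ (suc zero) zero = two
  N₀ k k⁻¹ (suc zero) (suc zero) = 1# - k
  N₀ k k⁻¹ (suc zero) (suc (suc zero)) = two
  N₀ k k⁻¹ (suc (suc zero)) zero = two * k⁻¹
  N₀ k k⁻¹ (suc (suc zero)) (suc zero) = two * k⁻¹
  N₀ k k⁻¹ (suc (suc zero)) (suc (suc zero)) = - (k⁻¹ * (k * k + k - two))

  𝐉 : Carrier → ℕ → Mat3
  𝐉 k n = Mₖ k ^ₘ n

  𝐣 : Carrier → Carrier → ℕ → Mat3
  𝐣 k k⁻¹ n = N₀ k k⁻¹ ⊗ (Mₖ k ^ₘ n)

-- N₀ commutes with M: entrywise, N₀M − MN₀ = (k k⁻¹ − 1)·D for an explicit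
-- polynomial matrix D, so the commutator vanishes once k⁻¹ inverts k.  Hence
-- N₀ commutes with every power of M, and both identities follow from
-- Mᵐ⁺ⁿ = MᵐMⁿ and associativity of the matrix product.
module Submission where

open import Algebra.Bundles using (CommutativeRing)
import Data.Nat as ℕ
open import Data.Integer as ℤ using (ℤ; +_; -[1+_]; _⊖_; _◃_)
import Data.Integer.Properties as ℤₚ
import Data.Nat.Properties as ℕₚ
import Data.Sign as Sign
open import Data.Maybe using (Maybe; just; nothing)
open import Relation.Nullary using (yes; no)
open import Relation.Binary.Bundles using (Setoid)
import Relation.Binary.PropositionalEquality as ≡
open import Algebra.Solver.Ring.AlmostCommutativeRing
  using (fromCommutativeRing; _-Raw-AlmostCommutative⟶_)

open import Defs

module IntegerCoefficientSolver {c ℓ} (R : CommutativeRing c ℓ) where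
  open CommutativeRing R
  open ℕ using (ℕ; zero; suc)
  open import Algebra.Properties.Ring ring
  open import Algebra.Properties.CommutativeSemigroup +-commutativeSemigroup using (interchange)
  open import Algebra.Properties.Semiring.Mult.TCOptimised semiring renaming (_×_ to _·_)
  open import Relation.Binary.Reasoning.Setoid setoid

  fromℕ : ℕ → Carrier
  fromℕ n = n · 1#

  fromℤ : ℤ → Carrier
  fromℤ (+ n)      = fromℕ n
  fromℤ -[1+ n ]   = - fromℕ (suc n)

  x≈x-0# : ∀ x → x ≈ x - 0#
  x≈x-0# x = sym (trans (+-congˡ -0#≈0#) (+-identityʳ x))

  1+x-[1+y]≈x-y : ∀ x y → (1# + x) - (1# + y) ≈ x - y
  1+x-[1+y]≈x-y x y = begin
    (1# + x) - (1# + y)       ≈⟨ +-congˡ (-‿+-comm 1# y) ⟨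
    (1# + x) + (- 1# + - y)   ≈⟨ interchange 1# x (- 1#) (- y) ⟩
    (1# - 1#) + (x - y)       ≈⟨ +-congʳ (-‿inverseʳ 1#) ⟩
    0# + (x - y)              ≈⟨ +-identityˡ _ ⟩
    x - y                     ∎

  fromℤ-⊖ : ∀ m n → fromℤ (m ⊖ n) ≈ fromℕ m - fromℕ n
  fromℤ-⊖ zero    zero    = x≈x-0# 0#
  fromℤ-⊖ (suc m) zero    = x≈x-0# _
  fromℤ-⊖ zero    (suc n) = sym (+-identityˡ _)
  fromℤ-⊖ (suc m) (suc n) = begin
    fromℤ (suc m ⊖ suc n)             ≡⟨ ≡.cong fromℤ (ℤₚ.[1+m]⊖[1+n]≡m⊖n m n) ⟩
    fromℤ (m ⊖ n)                     ≈⟨ fromℤ-⊖ m n ⟩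
    fromℕ m - fromℕ n                 ≈⟨ 1+x-[1+y]≈x-y _ _ ⟨
    (1# + fromℕ m) - (1# + fromℕ n)   ≈⟨ +-cong (1+× m 1#) (-‿cong (1+× n 1#)) ⟨
    fromℕ (suc m) - fromℕ (suc n)     ∎

  fromℤ-+◃ : ∀ n → fromℤ (Sign.+ ◃ n) ≈ fromℕ n
  fromℤ-+◃ zero    = refl
  fromℤ-+◃ (suc n) = refl

  fromℤ--◃ : ∀ n → fromℤ (Sign.- ◃ n) ≈ - fromℕ n
  fromℤ--◃ zero    = sym -0#≈0#
  fromℤ--◃ (suc n) = refl

  fromℤ-homo-+ : ∀ i j → fromℤ (i ℤ.+ j) ≈ fromℤ i + fromℤ j
  fromℤ-homo-+ (+ m)    (+ n)    = ×-homo-+ 1# m n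
  fromℤ-homo-+ (+ m)    -[1+ n ] = fromℤ-⊖ m (suc n)
  fromℤ-homo-+ -[1+ m ] (+ n)    = trans (fromℤ-⊖ n (suc m)) (+-comm _ _)
  fromℤ-homo-+ -[1+ m ] -[1+ n ] = begin
    - fromℕ (suc (suc (m ℕ.+ n)))       ≡⟨ ≡.cong (λ k → - fromℕ (suc k)) (ℕₚ.+-suc m n) ⟨
    - fromℕ (suc m ℕ.+ suc n)           ≈⟨ -‿cong (×-homo-+ 1# (suc m) (suc n)) ⟩
    - (fromℕ (suc m) + fromℕ (suc n))   ≈⟨ -‿+-comm _ _ ⟨
    - fromℕ (suc m) + - fromℕ (suc n)   ∎

  fromℤ-homo-* : ∀ i j → fromℤ (i ℤ.* j) ≈ fromℤ i * fromℤ j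
  fromℤ-homo-* (+ m) (+ n) = trans (fromℤ-+◃ (m ℕ.* n)) (×1-homo-* m n)
  fromℤ-homo-* (+ m) -[1+ n ] = begin
    fromℤ (Sign.- ◃ (m ℕ.* suc n))     ≈⟨ fromℤ--◃ (m ℕ.* suc n) ⟩
    - fromℕ (m ℕ.* suc n)              ≈⟨ -‿cong (×1-homo-* m (suc n)) ⟩
    - (fromℕ m * fromℕ (suc n))        ≈⟨ -‿distribʳ-* _ _ ⟩
    fromℕ m * - fromℕ (suc n)          ∎
  fromℤ-homo-* -[1+ m ] (+ n) = begin
    fromℤ (Sign.- ◃ (suc m ℕ.* n))     ≈⟨ fromℤ--◃ (suc m ℕ.* n) ⟩
    - fromℕ (suc m ℕ.* n)              ≈⟨ -‿cong (×1-homo-* (suc m) n) ⟩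
    - (fromℕ (suc m) * fromℕ n)        ≈⟨ -‿distribˡ-* _ _ ⟩
    - fromℕ (suc m) * fromℕ n          ∎
  fromℤ-homo-* -[1+ m ] -[1+ n ] = begin
    fromℤ (Sign.+ ◃ (suc m ℕ.* suc n))    ≈⟨ fromℤ-+◃ (suc m ℕ.* suc n) ⟩
    fromℕ (suc m ℕ.* suc n)               ≈⟨ ×1-homo-* (suc m) (suc n) ⟩
    fromℕ (suc m) * fromℕ (suc n)         ≈⟨ -‿involutive _ ⟨
    - - (fromℕ (suc m) * fromℕ (suc n))   ≈⟨ -‿cong (-‿distribˡ-* _ _) ⟩
    - (- fromℕ (suc m) * fromℕ (suc n))   ≈⟨ -‿distribʳ-* _ _ ⟩
    - fromℕ (suc m) * - fromℕ (suc n)     ∎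

  fromℤ-homo-- : ∀ i → fromℤ (ℤ.- i) ≈ - fromℤ i
  fromℤ-homo-- (+ zero)  = sym -0#≈0#
  fromℤ-homo-- (+ suc n) = refl
  fromℤ-homo-- -[1+ n ]  = sym (-‿involutive _)

  fromℤ-morphism : ℤ.+-*-rawRing -Raw-AlmostCommutative⟶ fromCommutativeRing R
  fromℤ-morphism = record
    { ⟦_⟧    = fromℤ
    ; +-homo = fromℤ-homo-+
    ; *-homo = fromℤ-homo-*
    ; -‿homo = fromℤ-homo--
    ; 0-homo = refl
    ; 1-homo = refl
    }

  fromℤ-weaklyDecidable : ∀ i j → Maybe (fromℤ i ≈ fromℤ j)
  fromℤ-weaklyDecidable i j with i ℤ.≟ j
  ... | yes ≡.refl = just refl
  ... | no _       = nothing

  open import Algebra.Solver.Ring ℤ.+-*-rawRing (fromCommutativeRing R)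
    fromℤ-morphism fromℤ-weaklyDecidable public

module Mat3Properties {c ℓ} (R : CommutativeRing c ℓ) where
  open CommutativeRing R hiding (zero)
  open Matrices R
  open IntegerCoefficientSolver R using (Polynomial; solve; con; _:+_; _:*_; _:=_)
  open import Data.Fin using (zero; suc)
  open ℕ using (zero; suc)

  ≈ₘ-setoid : Setoid c ℓ
  ≈ₘ-setoid = record
    { Carrier       = Mat3
    ; _≈_           = _≈ₘ_
    ; isEquivalence = record
      { refl  = λ _ _ → refl
      ; sym   = λ A≈B i j → sym (A≈B i j)
      ; trans = λ A≈B B≈C i j → trans (A≈B i j) (B≈C i j)
      }
    }

  open Setoid ≈ₘ-setoid public using () renaming (refl to ≈ₘ-refl; sym to ≈ₘ-sym)
  open import Relation.Binary.Reasoning.Setoid ≈ₘ-setoid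

  ⊗-cong : ∀ {A A′ B B′} → A ≈ₘ A′ → B ≈ₘ B′ → (A ⊗ B) ≈ₘ (A′ ⊗ B′)
  ⊗-cong A≈A′ B≈B′ i j =
    +-cong (+-cong (*-cong (A≈A′ i zero) (B≈B′ zero j))
                   (*-cong (A≈A′ i (suc zero)) (B≈B′ (suc zero) j)))
           (*-cong (A≈A′ i (suc (suc zero))) (B≈B′ (suc (suc zero)) j))

  ⊗-congˡ : ∀ A {B B′} → B ≈ₘ B′ → (A ⊗ B) ≈ₘ (A ⊗ B′)
  ⊗-congˡ A {B} {B′} = ⊗-cong {A} {A} {B} {B′} ≈ₘ-refl

  ⊗-congʳ : ∀ {A A′} B → A ≈ₘ A′ → (A ⊗ B) ≈ₘ (A′ ⊗ B)
  ⊗-congʳ {A} {A′} B A≈A′ = ⊗-cong {A} {A′} {B} {B} A≈A′ ≈ₘ-refl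

  ⊗-assoc : ∀ A B C → ((A ⊗ B) ⊗ C) ≈ₘ (A ⊗ (B ⊗ C))
  ⊗-assoc A B C i j =
    solve 15 (λ a₀ a₁ a₂ b₀₀ b₀₁ b₀₂ b₁₀ b₁₁ b₁₂ b₂₀ b₂₁ b₂₂ c₀ c₁ c₂ →
        (a₀ :* b₀₀ :+ a₁ :* b₁₀ :+ a₂ :* b₂₀) :* c₀
      :+ (a₀ :* b₀₁ :+ a₁ :* b₁₁ :+ a₂ :* b₂₁) :* c₁
      :+ (a₀ :* b₀₂ :+ a₁ :* b₁₂ :+ a₂ :* b₂₂) :* c₂
      := a₀ :* (b₀₀ :* c₀ :+ b₀₁ :* c₁ :+ b₀₂ :* c₂)
      :+ a₁ :* (b₁₀ :* c₀ :+ b₁₁ :* c₁ :+ b₁₂ :* c₂)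
      :+ a₂ :* (b₂₀ :* c₀ :+ b₂₁ :* c₁ :+ b₂₂ :* c₂)) refl
      (A i zero) (A i (suc zero)) (A i (suc (suc zero)))
      (B zero zero)             (B zero (suc zero))             (B zero (suc (suc zero)))
      (B (suc zero) zero)       (B (suc zero) (suc zero))       (B (suc zero) (suc (suc zero)))
      (B (suc (suc zero)) zero) (B (suc (suc zero)) (suc zero)) (B (suc (suc zero)) (suc (suc zero)))
      (C zero j) (C (suc zero) j) (C (suc (suc zero)) j)

  private
    0ₚ 1ₚ : ∀ {n} → Polynomial n
    0ₚ = con (+ 0)
    1ₚ = con (+ 1)

  ⊗-identityˡ : ∀ A → (I₃ ⊗ A) ≈ₘ A
  ⊗-identityˡ A zero             j = solve 3 (λ x y z → 1ₚ :* x :+ 0ₚ :* y :+ 0ₚ :* z := x) refl _ _ _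
  ⊗-identityˡ A (suc zero)       j = solve 3 (λ x y z → 0ₚ :* x :+ 1ₚ :* y :+ 0ₚ :* z := y) refl _ _ _
  ⊗-identityˡ A (suc (suc zero)) j = solve 3 (λ x y z → 0ₚ :* x :+ 0ₚ :* y :+ 1ₚ :* z := z) refl _ _ _

  ⊗-identityʳ : ∀ A → (A ⊗ I₃) ≈ₘ A
  ⊗-identityʳ A i zero             = solve 3 (λ x y z → x :* 1ₚ :+ y :* 0ₚ :+ z :* 0ₚ := x) refl _ _ _
  ⊗-identityʳ A i (suc zero)       = solve 3 (λ x y z → x :* 0ₚ :+ y :* 1ₚ :+ z :* 0ₚ := y) refl _ _ _
  ⊗-identityʳ A i (suc (suc zero)) = solve 3 (λ x y z → x :* 0ₚ :+ y :* 0ₚ :+ z :* 1ₚ := z) refl _ _ _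

  ^ₘ-distribˡ-+-⊗ : ∀ A m n → (A ^ₘ (m ℕ.+ n)) ≈ₘ ((A ^ₘ m) ⊗ (A ^ₘ n))
  ^ₘ-distribˡ-+-⊗ A zero    n = ≈ₘ-sym (⊗-identityˡ (A ^ₘ n))
  ^ₘ-distribˡ-+-⊗ A (suc m) n = begin
    A ⊗ (A ^ₘ (m ℕ.+ n))          ≈⟨ ⊗-congˡ A (^ₘ-distribˡ-+-⊗ A m n) ⟩
    A ⊗ ((A ^ₘ m) ⊗ (A ^ₘ n))     ≈⟨ ⊗-assoc A (A ^ₘ m) (A ^ₘ n) ⟨
    (A ⊗ (A ^ₘ m)) ⊗ (A ^ₘ n)     ∎

  ⊗-commute-^ₘ : ∀ A B → (A ⊗ B) ≈ₘ (B ⊗ A) → ∀ n → (A ⊗ (B ^ₘ n)) ≈ₘ ((B ^ₘ n) ⊗ A)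
  ⊗-commute-^ₘ A B AB≈BA zero = begin
    A ⊗ I₃   ≈⟨ ⊗-identityʳ A ⟩
    A        ≈⟨ ⊗-identityˡ A ⟨
    I₃ ⊗ A   ∎
  ⊗-commute-^ₘ A B AB≈BA (suc n) = begin
    A ⊗ (B ⊗ (B ^ₘ n))     ≈⟨ ⊗-assoc A B (B ^ₘ n) ⟨
    (A ⊗ B) ⊗ (B ^ₘ n)     ≈⟨ ⊗-congʳ (B ^ₘ n) AB≈BA ⟩
    (B ⊗ A) ⊗ (B ^ₘ n)     ≈⟨ ⊗-assoc B A (B ^ₘ n) ⟩
    B ⊗ (A ⊗ (B ^ₘ n))     ≈⟨ ⊗-congˡ B (⊗-commute-^ₘ A B AB≈BA n) ⟩
    B ⊗ ((B ^ₘ n) ⊗ A)     ≈⟨ ⊗-assoc B (B ^ₘ n) A ⟨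
    (B ⊗ (B ^ₘ n)) ⊗ A     ∎

module Commutation {c ℓ} (R : CommutativeRing c ℓ) where
  open CommutativeRing R hiding (zero)
  open Matrices R
  open IntegerCoefficientSolver R
    using (Polynomial; solve; con; _:+_; _:*_; _:-_; :-_; _:=_)
  open import Data.Fin using (Fin; zero; suc)
  open import Data.Product using (_×_)

  -- The solver works on syntax, so Mₖ and N₀ are restated as matrices of
  -- polynomials in k and k⁻¹ (the variables x and y below).
  private
    PolyMat3 : Set
    PolyMat3 = Fin 3 → Fin 3 → Polynomial 2

    0ₚ 1ₚ 2ₚ : Polynomial 2
    0ₚ = con (+ 0)
    1ₚ = con (+ 1)
    2ₚ = con (+ 2)

    _⊗ₚ_ : PolyMat3 → PolyMat3 → PolyMat3
    (A ⊗ₚ B) i j = A i zero :* B zero j :+ A i (suc zero) :* B (suc zero) j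
                     :+ A i (suc (suc zero)) :* B (suc (suc zero)) j

    Mₚ : Polynomial 2 → PolyMat3
    Mₚ x zero             zero             = x :- 1ₚ
    Mₚ x zero             (suc zero)       = x :- 1ₚ
    Mₚ x zero             (suc (suc zero)) = x
    Mₚ x (suc zero)       zero             = 1ₚ
    Mₚ x (suc zero)       (suc zero)       = 0ₚ
    Mₚ x (suc zero)       (suc (suc zero)) = 0ₚ
    Mₚ x (suc (suc zero)) zero             = 0ₚ
    Mₚ x (suc (suc zero)) (suc zero)       = 1ₚ
    Mₚ x (suc (suc zero)) (suc (suc zero)) = 0ₚ

    N₀ₚ : Polynomial 2 → Polynomial 2 → PolyMat3
    N₀ₚ x y zero             zero             = x :- 1ₚ
    N₀ₚ x y zero             (suc zero)       = 2ₚ :* x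
    N₀ₚ x y zero             (suc (suc zero)) = 2ₚ :* x
    N₀ₚ x y (suc zero)       zero             = 2ₚ
    N₀ₚ x y (suc zero)       (suc zero)       = 1ₚ :- x
    N₀ₚ x y (suc zero)       (suc (suc zero)) = 2ₚ
    N₀ₚ x y (suc (suc zero)) zero             = 2ₚ :* y
    N₀ₚ x y (suc (suc zero)) (suc zero)       = 2ₚ :* y
    N₀ₚ x y (suc (suc zero)) (suc (suc zero)) = :- (y :* (x :* x :+ x :- 2ₚ))

    commutatorQuotient : Polynomial 2 → PolyMat3
    commutatorQuotient x zero             zero             = :- 2ₚ
    commutatorQuotient x zero             (suc zero)       = :- 2ₚ
    commutatorQuotient x zero             (suc (suc zero)) = x :* x :+ x :- 2ₚ
    commutatorQuotient x (suc zero)       _                = 0ₚ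
    commutatorQuotient x (suc (suc zero)) zero             = 2ₚ
    commutatorQuotient x (suc (suc zero)) (suc zero)       = 1ₚ :- x
    commutatorQuotient x (suc (suc zero)) (suc (suc zero)) = 2ₚ

    commutator-identity : Fin 3 → Fin 3 → Polynomial 2 → Polynomial 2 → Polynomial 2 × Polynomial 2
    commutator-identity i j x y =
      (N₀ₚ x y ⊗ₚ Mₚ x) i j := (Mₚ x ⊗ₚ N₀ₚ x y) i j :+ (x :* y :- 1ₚ) :* commutatorQuotient x i j

  module _ (k k⁻¹ : Carrier) (k*k⁻¹≈1 : k * k⁻¹ ≈ 1#) where

    ≈-modulo-k*k⁻¹-1 : ∀ {a b} q → a ≈ b + (k * k⁻¹ - 1#) * q → a ≈ b
    ≈-modulo-k*k⁻¹-1 {a} {b} q a≈b+εq = begin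
      a                         ≈⟨ a≈b+εq ⟩
      b + (k * k⁻¹ - 1#) * q    ≈⟨ +-congˡ (*-congʳ (+-congʳ k*k⁻¹≈1)) ⟩
      b + (1# - 1#) * q         ≈⟨ +-congˡ (*-congʳ (-‿inverseʳ 1#)) ⟩
      b + 0# * q                ≈⟨ +-congˡ (zeroˡ q) ⟩
      b + 0#                    ≈⟨ +-identityʳ b ⟩
      b                         ∎
      where open import Relation.Binary.Reasoning.Setoid setoid

    N₀-⊗-comm-Mₖ : (N₀ k k⁻¹ ⊗ Mₖ k) ≈ₘ (Mₖ k ⊗ N₀ k k⁻¹)
    N₀-⊗-comm-Mₖ zero             zero             = ≈-modulo-k*k⁻¹-1 _ (solve 2 (commutator-identity zero zero) refl k k⁻¹)
    N₀-⊗-comm-Mₖ zero             (suc zero)       = ≈-modulo-k*k⁻¹-1 _ (solve 2 (commutator-identity zero (suc zero)) refl k k⁻¹)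
    N₀-⊗-comm-Mₖ zero             (suc (suc zero)) = ≈-modulo-k*k⁻¹-1 _ (solve 2 (commutator-identity zero (suc (suc zero))) refl k k⁻¹)
    N₀-⊗-comm-Mₖ (suc zero)       zero             = ≈-modulo-k*k⁻¹-1 _ (solve 2 (commutator-identity (suc zero) zero) refl k k⁻¹)
    N₀-⊗-comm-Mₖ (suc zero)       (suc zero)       = ≈-modulo-k*k⁻¹-1 _ (solve 2 (commutator-identity (suc zero) (suc zero)) refl k k⁻¹)
    N₀-⊗-comm-Mₖ (suc zero)       (suc (suc zero)) = ≈-modulo-k*k⁻¹-1 _ (solve 2 (commutator-identity (suc zero) (suc (suc zero))) refl k k⁻¹)
    N₀-⊗-comm-Mₖ (suc (suc zero)) zero             = ≈-modulo-k*k⁻¹-1 _ (solve 2 (commutator-identity (suc (suc zero)) zero) refl k k⁻¹)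
    N₀-⊗-comm-Mₖ (suc (suc zero)) (suc zero)       = ≈-modulo-k*k⁻¹-1 _ (solve 2 (commutator-identity (suc (suc zero)) (suc zero)) refl k k⁻¹)
    N₀-⊗-comm-Mₖ (suc (suc zero)) (suc (suc zero)) = ≈-modulo-k*k⁻¹-1 _ (solve 2 (commutator-identity (suc (suc zero)) (suc (suc zero))) refl k k⁻¹)

open import Data.Nat using (ℕ; _+_; _≤_)
open import Data.Product using (_×_; _,_)

theorem2p4 : ∀ {c ℓ} (R : CommutativeRing c ℓ) (k k⁻¹ : CommutativeRing.Carrier R) → CommutativeRing._≈_ R (CommutativeRing._*_ R k k⁻¹) (CommutativeRing.1# R) → (m n : ℕ) → 1 ≤ m → 1 ≤ n → let open Matrices R in (𝐣 k k⁻¹ (m + n) ≈ₘ (𝐣 k k⁻¹ m ⊗ 𝐉 k n)) × ((𝐣 k k⁻¹ m ⊗ 𝐉 k n) ≈ₘ (𝐉 k m ⊗ 𝐣 k k⁻¹ n))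
theorem2p4 R k k⁻¹ k*k⁻¹≈1 m n _ _ = 𝐣-+ , 𝐣-⊗-𝐉-comm
  where
  open Matrices R
  open Mat3Properties R
  open Commutation R using (N₀-⊗-comm-Mₖ)
  open import Relation.Binary.Reasoning.Setoid ≈ₘ-setoid

  M N : Mat3
  M = Mₖ k
  N = N₀ k k⁻¹

  𝐣-+ : (N ⊗ (M ^ₘ (m + n))) ≈ₘ ((N ⊗ (M ^ₘ m)) ⊗ (M ^ₘ n))
  𝐣-+ = begin
    N ⊗ (M ^ₘ (m + n))           ≈⟨ ⊗-congˡ N (^ₘ-distribˡ-+-⊗ M m n) ⟩
    N ⊗ ((M ^ₘ m) ⊗ (M ^ₘ n))    ≈⟨ ⊗-assoc N (M ^ₘ m) (M ^ₘ n) ⟨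
    (N ⊗ (M ^ₘ m)) ⊗ (M ^ₘ n)    ∎

  𝐣-⊗-𝐉-comm : ((N ⊗ (M ^ₘ m)) ⊗ (M ^ₘ n)) ≈ₘ ((M ^ₘ m) ⊗ (N ⊗ (M ^ₘ n)))
  𝐣-⊗-𝐉-comm = begin
    (N ⊗ (M ^ₘ m)) ⊗ (M ^ₘ n)    ≈⟨ ⊗-congʳ (M ^ₘ n) (⊗-commute-^ₘ N M (N₀-⊗-comm-Mₖ k k⁻¹ k*k⁻¹≈1) m) ⟩
    ((M ^ₘ m) ⊗ N) ⊗ (M ^ₘ n)    ≈⟨ ⊗-assoc (M ^ₘ m) N (M ^ₘ n) ⟩
    (M ^ₘ m) ⊗ (N ⊗ (M ^ₘ n))    ∎
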